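{- Let $n\ge 4$, $N=\{1,\dots,n\}$, let $i_1,i_2\in N$ with $i_1\ne i_2$, and let $\hat N^c=N\setminus\{i_1,i_2\}$. Then the inequality $$x_{i_1i_2}+\sum_{j\in\hat N^c}\left(x_{i_1j}+x_{ji_1}\right)-\sum_{j,j'\in\hat N^c:\ j\ne j'} x_{jj'}-\sum_{j\in\hat N^c}x_{ji_2}\ \le\ 2-\frac{(n-3)(n-4)}{2}$$ is a valid inequality for the weak order polytope $P^n_{WO}$.
   Context: Let $N=\{1,\dots,n\}$ and $A_N=\{(i,j): i,j\in N,\ i\ne j\}$. A weak order on $N$ is a binary relation $W\subseteq N\times N$ that is reflexive, transitive and total; $(i,j)\in W$ is read "$i$ is preferred over or tied with $j$". The characteristic vector of $W$ is $x^W\in\{0,1\}^{A_N}$ with $x^W_{ij}=1$ if $(i,j)\in W$ and $0$ otherwise. The weak order polytope $P^n_{WO}\subseteq\mathbb{R}^{A_N}$ is the convex hull of the characteristic vectors of all weak orders on $N$. An inequality $\pi x\le\pi_0$ is valid for $P$ if it holds for every $x\in P$.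
   Formalization: The weak order polytope $P^n_{WO}$ consists only of points with rational coordinates that are convex combinations with rational weights, rather than points of $\mathbb{R}^{A_N}$ with real weights. -}

module Defs where

open import Data.Bool using (Bool; true; false; if_then_else_; _∧_; not)
open import Data.Nat as ℕ using (ℕ; _∸_)
open import Data.Integer using (+_)
open import Data.Fin using (Fin; _≟_)
open import Data.List using (List; []; _∷_; map; allFin; foldr)
open import Data.Product using (Σ; _×_; _,_; proj₁; proj₂)
open import Data.Sum using (_⊎_)
open import Data.Rational using (ℚ; 0ℚ; 1ℚ; _+_; _*_; _-_; _≤_; _/_)
open import Relation.Nullary using (¬_; does)
open import Relation.Binary.PropositionalEquality using (_≡_)
open import Data.List.Relation.Unary.All using (All)

-- A binary relation on N = Fin n, given by its (decidable) characteristic function: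
-- R i j ≡ true  means  "i is preferred over or tied with j".
Rel₂ : ℕ → Set
Rel₂ n = Fin n → Fin n → Bool

record WeakOrder (n : ℕ) : Set where
  field
    R     : Rel₂ n
    refl  : ∀ i → R i i ≡ true
    trans : ∀ i j k → R i j ≡ true → R j k ≡ true → R i k ≡ true
    total : ∀ i j → R i j ≡ true ⊎ R j i ≡ true

-- Points of R^{A_N}, represented (over ℚ) as functions on N × N;
-- diagonal entries are ignored everywhere.
Point : ℕ → Set
Point n = Fin n → Fin n → ℚ

charVec : ∀ {n} → WeakOrder n → Point n
charVec W i j = if WeakOrder.R W i j then 1ℚ else 0ℚ

sumℚ : List ℚ → ℚ
sumℚ = foldr _+_ 0ℚ

Σ[N] : ∀ {n} → (Fin n → ℚ) → ℚ
Σ[N] {n} f = sumℚ (map f (allFin n))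

-- Membership in the weak order polytope P^n_WO = conv{ x^W : W weak order on N }:
-- x is a convex combination (finitely many nonnegative rational weights summing to 1)
-- of characteristic vectors of weak orders, coordinatewise on A_N.
InPWO : (n : ℕ) → Point n → Set
InPWO n x =
  Σ (List (ℚ × WeakOrder n)) λ cs →
    All (λ c → 0ℚ ≤ proj₁ c) cs
    × sumℚ (map proj₁ cs) ≡ 1ℚ
    × (∀ i j → ¬ (i ≡ j) →
         x i j ≡ sumℚ (map (λ c → proj₁ c * charVec (proj₂ c) i j) cs))

ValidForPWO : (n : ℕ) → (Point n → ℚ) → ℚ → Set
ValidForPWO n lhs rhs = ∀ (x : Point n) → InPWO n x → lhs x ≤ rhs

inNc : ∀ {n} → Fin n → Fin n → Fin n → Bool
inNc i₁ i₂ j = not (does (j ≟ i₁)) ∧ not (does (j ≟ i₂))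

ΣNc : ∀ {n} → Fin n → Fin n → (Fin n → ℚ) → ℚ
ΣNc i₁ i₂ f = Σ[N] (λ j → if inNc i₁ i₂ j then f j else 0ℚ)

ΣNc² : ∀ {n} → Fin n → Fin n → (Fin n → Fin n → ℚ) → ℚ
ΣNc² i₁ i₂ f =
  ΣNc i₁ i₂ (λ j → ΣNc i₁ i₂ (λ j' → if does (j ≟ j') then 0ℚ else f j j'))

lhs4 : ∀ {n} → Fin n → Fin n → Point n → ℚ
lhs4 i₁ i₂ x =
  ((x i₁ i₂ + ΣNc i₁ i₂ (λ j → x i₁ j + x j i₁))
    - ΣNc² i₁ i₂ x)
    - ΣNc i₁ i₂ (λ j → x j i₂)

-- Right-hand side 2 - (n-3)(n-4)/2  (for n ≥ 4 the truncated subtraction is exact).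
rhs4 : ℕ → ℚ
rhs4 n = (+ 2 / 1) - (+ ((n ∸ 3) ℕ.* (n ∸ 4)) / 2)

-- The left-hand side is linear and depends only on arc coordinates, so it suffices to bound it at
-- the characteristic vector x of a weak order. Let k = |N̂ᶜ| = n − 2 and let b be the number of
-- j ∈ N̂ᶜ tied with i₁ but not weakly preferred to i₂. Such a j contributes at most 2 to
-- x_{i₁j} + x_{ji₁} − x_{ji₂} and every other j at most 1, while every pair j ≠ j′ in N̂ᶜ contributes
-- at least 1 to x_{jj′} + x_{j′j}, and 2 if both lie in that tied class. Hence the left-hand side is at
-- most x_{i₁i₂} + (b − C(b,2)) + (k − C(k,2)). If i₁ is weakly preferred to i₂ the class is empty and
-- x_{i₁i₂} ≤ 1; otherwise x_{i₁i₂} = 0 and b − C(b,2) ≤ 1. Either way the bound is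
-- 1 + k − C(k,2) = 2 − (n−3)(n−4)/2.

module Submission where

open import Defs
open import Data.Bool using (Bool; true; false; if_then_else_; _∧_; not; T; T?)
open import Data.Bool.Properties using (∧-conicalˡ; ∧-conicalʳ; ∧-zeroʳ)
open import Data.Nat as ℕ using (ℕ; zero; suc; s≤s)
import Data.Nat.Properties as ℕₚ
import Data.Nat.Solver as ℕ-Solver
import Data.Integer as ℤ
import Data.Integer.Properties as ℤₚ
open import Data.Fin using (Fin; _≟_)
open import Data.List using (List; []; _∷_; map; allFin; length; filterᵇ)
import Data.List.Properties as Listₚ
open import Data.List.Relation.Unary.All as All using (All; []; _∷_)
open import Data.List.Relation.Unary.Any using (here; there)
open import Data.List.Membership.Propositional using (_∈_)
open import Data.List.Relation.Unary.AllPairs using ([]; _∷_)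
open import Data.List.Relation.Unary.Unique.Propositional using (Unique)
import Data.List.Relation.Unary.Unique.Propositional.Properties as Uniqueₚ
open import Data.List.Membership.Propositional.Properties using (∈-allFin)
open import Data.Product using (_×_; _,_; proj₁; proj₂)
open import Data.Sum using (inj₁; inj₂)
open import Data.Empty using (⊥-elim)
open import Data.Rational as ℚ using (ℚ; 0ℚ; 1ℚ; _+_; _*_; _-_; -_; _/_; _≤_; toℚᵘ)
import Data.Rational.Properties as ℚₚ
import Data.Rational.Unnormalised as ℚᵘ
import Data.Rational.Unnormalised.Properties as ℚᵘₚ
open import Data.Rational.Solver using (module +-*-Solver)
open import Relation.Nullary using (¬_; does; yes; no)
open import Relation.Nullary.Decidable using (True; toWitness; dec-true; dec-false)
open import Relation.Binary.PropositionalEquality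
open import Function using (_∘_; id)

open import Algebra.Properties.CommutativeSemigroup ℕₚ.+-commutativeSemigroup using (interchange)

fromℕ : ℕ → ℚ
fromℕ m = ℤ.+ m / 1

private
  toℚᵘ-fromℕ : ∀ m → toℚᵘ (fromℕ m) ℚᵘ.≃ ℚᵘ.mkℚᵘ (ℤ.+ m) 0
  toℚᵘ-fromℕ m = ℚₚ.toℚᵘ-fromℚᵘ (ℚᵘ.mkℚᵘ (ℤ.+ m) 0)

fromℕ-+ : ∀ m n → fromℕ (m ℕ.+ n) ≡ fromℕ m + fromℕ n
fromℕ-+ m n = ℚₚ.toℚᵘ-injective (begin
  toℚᵘ (fromℕ (m ℕ.+ n))                    ≈⟨ toℚᵘ-fromℕ (m ℕ.+ n) ⟩
  ℚᵘ.mkℚᵘ (ℤ.+ (m ℕ.+ n)) 0                  ≈⟨ ℚᵘ.*≡* num ⟩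
  ℚᵘ.mkℚᵘ (ℤ.+ m) 0 ℚᵘ.+ ℚᵘ.mkℚᵘ (ℤ.+ n) 0   ≈⟨ ℚᵘₚ.+-cong (toℚᵘ-fromℕ m) (toℚᵘ-fromℕ n) ⟨
  toℚᵘ (fromℕ m) ℚᵘ.+ toℚᵘ (fromℕ n)         ≈⟨ ℚₚ.toℚᵘ-homo-+ (fromℕ m) (fromℕ n) ⟨
  toℚᵘ (fromℕ m + fromℕ n)                   ∎)
  where
  open ℚᵘₚ.≃-Reasoning
  num : ℤ.+ (m ℕ.+ n) ℤ.* ℤ.+ 1 ≡ (ℤ.+ m ℤ.* ℤ.+ 1 ℤ.+ ℤ.+ n ℤ.* ℤ.+ 1) ℤ.* ℤ.+ 1
  num = cong (ℤ._* ℤ.+ 1)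
             (trans (ℤₚ.pos-+ m n) (sym (cong₂ ℤ._+_ (ℤₚ.*-identityʳ (ℤ.+ m)) (ℤₚ.*-identityʳ (ℤ.+ n)))))

fromℕ-suc : ∀ m → fromℕ (suc m) ≡ 1ℚ + fromℕ m
fromℕ-suc = fromℕ-+ 1

[m+m]/2≡fromℕ : ∀ m → ℤ.+ (m ℕ.+ m) / 2 ≡ fromℕ m
[m+m]/2≡fromℕ m = ℚₚ.toℚᵘ-injective (begin
  toℚᵘ (ℤ.+ (m ℕ.+ m) / 2)   ≈⟨ ℚₚ.toℚᵘ-fromℚᵘ (ℚᵘ.mkℚᵘ (ℤ.+ (m ℕ.+ m)) 1) ⟩
  ℚᵘ.mkℚᵘ (ℤ.+ (m ℕ.+ m)) 1  ≈⟨ ℚᵘ.*≡* num ⟩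
  ℚᵘ.mkℚᵘ (ℤ.+ m) 0          ≈⟨ toℚᵘ-fromℕ m ⟨
  toℚᵘ (fromℕ m)             ∎)
  where
  open ℚᵘₚ.≃-Reasoning
  num : ℤ.+ (m ℕ.+ m) ℤ.* ℤ.+ 1 ≡ ℤ.+ m ℤ.* ℤ.+ 2
  m+m≡m*2 : m ℕ.+ m ≡ m ℕ.* 2
  m+m≡m*2 = trans (cong (m ℕ.+_) (sym (ℕₚ.+-identityʳ m))) (ℕₚ.*-comm 2 m)
  num = trans (ℤₚ.*-identityʳ _) (trans (cong ℤ.+_ m+m≡m*2) (ℤₚ.pos-* m 2))

fromℕ-nonNeg : ∀ m → 0ℚ ≤ fromℕ m
fromℕ-nonNeg m = ℚₚ.nonNegative⁻¹ (fromℕ m) {{ℚₚ.normalize-nonNeg m 1}}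

C₂ : ℕ → ℕ
C₂ zero    = 0
C₂ (suc m) = m ℕ.+ C₂ m

C₂-double : ∀ m → C₂ m ℕ.+ C₂ m ≡ m ℕ.* (m ℕ.∸ 1)
C₂-double zero          = refl
C₂-double (suc zero)    = refl
C₂-double (suc (suc m)) = begin
  (suc m ℕ.+ C₂ (suc m)) ℕ.+ (suc m ℕ.+ C₂ (suc m))
    ≡⟨ interchange (suc m) (C₂ (suc m)) (suc m) (C₂ (suc m)) ⟩
  (suc m ℕ.+ suc m) ℕ.+ (C₂ (suc m) ℕ.+ C₂ (suc m))
    ≡⟨ cong ((suc m ℕ.+ suc m) ℕ.+_) (C₂-double (suc m)) ⟩
  (suc m ℕ.+ suc m) ℕ.+ suc m ℕ.* m
    ≡⟨ solve 1 (λ m → ((con 1 :+ m) :+ (con 1 :+ m)) :+ (con 1 :+ m) :* m := (con 2 :+ m) :* (con 1 :+ m))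
               refl m ⟩
  suc (suc m) ℕ.* suc m ∎
  where
  open ≡-Reasoning
  open ℕ-Solver.+-*-Solver

≤-byComputation : ∀ {p q : ℚ} {p≤q : True (p ℚₚ.≤? q)} → p ≤ q
≤-byComputation {p≤q = p≤q} = toWitness p≤q

m-C₂m≤1 : ∀ m → fromℕ m - fromℕ (C₂ m) ≤ 1ℚ
m-C₂m≤1 zero    = ≤-byComputation
m-C₂m≤1 (suc m) = begin
  fromℕ (suc m) - fromℕ (m ℕ.+ C₂ m)
    ≡⟨ cong₂ _-_ (fromℕ-suc m) (fromℕ-+ m (C₂ m)) ⟩
  (1ℚ + fromℕ m) - (fromℕ m + fromℕ (C₂ m))
    ≡⟨ solve 2 (λ a c → (con 1ℚ :+ a) :- (a :+ c) := con 1ℚ :- c) refl (fromℕ m) (fromℕ (C₂ m)) ⟩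
  1ℚ - fromℕ (C₂ m)
    ≤⟨ ℚₚ.+-monoʳ-≤ 1ℚ (ℚₚ.neg-antimono-≤ (fromℕ-nonNeg (C₂ m))) ⟩
  1ℚ ∎
  where
  open ℚₚ.≤-Reasoning
  open +-*-Solver

∑ : {A : Set} → List A → (A → ℚ) → ℚ
∑ L f = sumℚ (map f L)

syntax ∑ L (λ x → e) = ∑[ x ∈ L ] e

𝟙 : Bool → ℚ
𝟙 b = if b then 1ℚ else 0ℚ

module _ {A : Set} where

  ∑-cong : ∀ (L : List A) {f g : A → ℚ} → (∀ {x} → x ∈ L → f x ≡ g x) → ∑ L f ≡ ∑ L g
  ∑-cong []      f≡g = refl
  ∑-cong (x ∷ L) f≡g = cong₂ _+_ (f≡g (here refl)) (∑-cong L (λ x∈L → f≡g (there x∈L)))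

  ∑-mono-≤ : ∀ (L : List A) {f g : A → ℚ} → (∀ {x} → x ∈ L → f x ≤ g x) → ∑ L f ≤ ∑ L g
  ∑-mono-≤ []      f≤g = ℚₚ.≤-refl
  ∑-mono-≤ (x ∷ L) f≤g = ℚₚ.+-mono-≤ (f≤g (here refl)) (∑-mono-≤ L (λ x∈L → f≤g (there x∈L)))

  ∑-+ : ∀ (L : List A) (f g : A → ℚ) → ∑[ x ∈ L ] (f x + g x) ≡ ∑ L f + ∑ L g
  ∑-+ []      f g = refl
  ∑-+ (x ∷ L) f g = begin
    (f x + g x) + ∑[ y ∈ L ] (f y + g y)
      ≡⟨ cong ((f x + g x) +_) (∑-+ L f g) ⟩
    (f x + g x) + (∑ L f + ∑ L g)
      ≡⟨ solve 4 (λ a b c d → (a :+ b) :+ (c :+ d) := (a :+ c) :+ (b :+ d)) refl (f x) (g x) (∑ L f) (∑ L g) ⟩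
    (f x + ∑ L f) + (g x + ∑ L g) ∎
    where
    open ≡-Reasoning
    open +-*-Solver

  ∑-*ˡ : ∀ (L : List A) a (f : A → ℚ) → ∑[ x ∈ L ] (a * f x) ≡ a * ∑ L f
  ∑-*ˡ []      a f = sym (ℚₚ.*-zeroʳ a)
  ∑-*ˡ (x ∷ L) a f = trans (cong (a * f x +_) (∑-*ˡ L a f)) (sym (ℚₚ.*-distribˡ-+ a (f x) (∑ L f)))

  ∑-filterᵇ : ∀ (P : A → Bool) (L : List A) (f : A → ℚ) →
              ∑[ x ∈ L ] (if P x then f x else 0ℚ) ≡ ∑ (filterᵇ P L) f
  ∑-filterᵇ P []      f = refl
  ∑-filterᵇ P (x ∷ L) f with P x
  ... | true  = cong (f x +_) (∑-filterᵇ P L f)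
  ... | false = trans (ℚₚ.+-identityˡ _) (∑-filterᵇ P L f)

  ∑-1 : ∀ (L : List A) → ∑[ x ∈ L ] 1ℚ ≡ fromℕ (length L)
  ∑-1 []      = refl
  ∑-1 (x ∷ L) = trans (cong (1ℚ +_) (∑-1 L)) (sym (fromℕ-suc (length L)))

  ∑-𝟙 : ∀ (P : A → Bool) (L : List A) → ∑[ x ∈ L ] 𝟙 (P x) ≡ fromℕ (length (filterᵇ P L))
  ∑-𝟙 P L = trans (∑-filterᵇ P L (λ _ → 1ℚ)) (∑-1 (filterᵇ P L))

module _ {n : ℕ} where

  Linear : (Point n → ℚ) → Set
  Linear f = ∀ a (u y : Point n) → f (λ i j → a * u i j + y i j) ≡ a * f u + f y

  ArcDetermined : (Point n → ℚ) → Set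
  ArcDetermined f = ∀ (x y : Point n) → (∀ i j → ¬ i ≡ j → x i j ≡ y i j) → f x ≡ f y

  linear⇒zero : ∀ {f} → Linear f → f (λ _ _ → 0ℚ) ≡ 0ℚ
  linear⇒zero {f} f-lin =
    trans (f-lin (- 1ℚ) z z) (solve 1 (λ a → con (- 1ℚ) :* a :+ a := con 0ℚ) refl (f z))
    where
    open +-*-Solver
    z : Point n
    z _ _ = 0ℚ

  coord-linear : ∀ i j → Linear (λ x → x i j)
  coord-linear i j a u y = refl

  zero-linear : Linear (λ _ → 0ℚ)
  zero-linear a u y = sym (trans (cong (_+ 0ℚ) (ℚₚ.*-zeroʳ a)) (ℚₚ.+-identityʳ 0ℚ))

  +-linear : ∀ {f g} → Linear f → Linear g → Linear (λ x → f x + g x)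
  +-linear {f} {g} f-lin g-lin a u y =
    trans (cong₂ _+_ (f-lin a u y) (g-lin a u y))
          (solve 5 (λ a fu fy gu gy → (a :* fu :+ fy) :+ (a :* gu :+ gy) := a :* (fu :+ gu) :+ (fy :+ gy))
                 refl a (f u) (f y) (g u) (g y))
    where open +-*-Solver

  -‿linear : ∀ {f g} → Linear f → Linear g → Linear (λ x → f x - g x)
  -‿linear {f} {g} f-lin g-lin a u y =
    trans (cong₂ _-_ (f-lin a u y) (g-lin a u y))
          (solve 5 (λ a fu fy gu gy → (a :* fu :+ fy) :- (a :* gu :+ gy) := a :* (fu :- gu) :+ (fy :- gy))
                 refl a (f u) (f y) (g u) (g y))
    where open +-*-Solver

  if-linear : ∀ b {f g} → Linear f → Linear g → Linear (λ x → if b then f x else g x)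
  if-linear true  f-lin _     = f-lin
  if-linear false _     g-lin = g-lin

  ∑-linear : ∀ {A : Set} (L : List A) {φ : A → Point n → ℚ} → (∀ j → Linear (φ j)) →
             Linear (λ x → ∑[ j ∈ L ] φ j x)
  ∑-linear L {φ} φ-lin a u y = begin
    ∑[ j ∈ L ] φ j (λ i k → a * u i k + y i k)  ≡⟨ ∑-cong L (λ {j} _ → φ-lin j a u y) ⟩
    ∑[ j ∈ L ] (a * φ j u + φ j y)              ≡⟨ ∑-+ L (λ j → a * φ j u) (λ j → φ j y) ⟩
    ∑[ j ∈ L ] (a * φ j u) + ∑[ j ∈ L ] φ j y   ≡⟨ cong (_+ ∑[ j ∈ L ] φ j y) (∑-*ˡ L a (λ j → φ j u)) ⟩
    a * ∑[ j ∈ L ] φ j u + ∑[ j ∈ L ] φ j y     ∎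
    where open ≡-Reasoning

  coord-arcDetermined : ∀ {i j} → ¬ i ≡ j → ArcDetermined (λ x → x i j)
  coord-arcDetermined {i} {j} i≢j x y x≡y = x≡y i j i≢j

  zero-arcDetermined : ArcDetermined (λ _ → 0ℚ)
  zero-arcDetermined x y _ = refl

  +-arcDetermined : ∀ {f g} → ArcDetermined f → ArcDetermined g → ArcDetermined (λ x → f x + g x)
  +-arcDetermined f-ad g-ad x y x≡y = cong₂ _+_ (f-ad x y x≡y) (g-ad x y x≡y)

  -‿arcDetermined : ∀ {f g} → ArcDetermined f → ArcDetermined g → ArcDetermined (λ x → f x - g x)
  -‿arcDetermined f-ad g-ad x y x≡y = cong₂ _-_ (f-ad x y x≡y) (g-ad x y x≡y)

  if-arcDetermined : ∀ b {f g} → (T b → ArcDetermined f) → (T (not b) → ArcDetermined g) →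
                     ArcDetermined (λ x → if b then f x else g x)
  if-arcDetermined true  f-ad _    = f-ad _
  if-arcDetermined false _    g-ad = g-ad _

  ∑-arcDetermined : ∀ {A : Set} (L : List A) {φ : A → Point n → ℚ} → (∀ j → ArcDetermined (φ j)) →
                    ArcDetermined (λ x → ∑[ j ∈ L ] φ j x)
  ∑-arcDetermined L φ-ad x y x≡y = ∑-cong L (λ {j} _ → φ-ad j x y x≡y)

validForPWO-fromVertices : ∀ {n} {f : Point n → ℚ} {r} → Linear f → ArcDetermined f →
                           (∀ W → f (charVec W) ≤ r) → ValidForPWO n f r
validForPWO-fromVertices {n} {f} {r} f-lin f-ad f[W]≤r x (cs , cs≥0 , ∑cs≡1 , x≡cs) = begin
  f x                                               ≡⟨ f-ad x (combination cs) x≡cs ⟩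
  f (combination cs)                                ≡⟨ f-combination cs ⟩
  ∑[ c ∈ cs ] (proj₁ c * f (charVec (proj₂ c)))     ≤⟨ ∑-mono-≤ cs weighted-bound ⟩
  ∑[ c ∈ cs ] (proj₁ c * r)                         ≡⟨ ∑-cong cs (λ _ → ℚₚ.*-comm _ r) ⟩
  ∑[ c ∈ cs ] (r * proj₁ c)                         ≡⟨ ∑-*ˡ cs r proj₁ ⟩
  r * ∑ cs proj₁                                    ≡⟨ cong (r *_) ∑cs≡1 ⟩
  r * 1ℚ                                            ≡⟨ ℚₚ.*-identityʳ r ⟩
  r                                                 ∎
  where
  open ℚₚ.≤-Reasoning
  combination : List (ℚ × WeakOrder n) → Point n
  combination cs i j = ∑[ c ∈ cs ] (proj₁ c * charVec (proj₂ c) i j)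

  f-combination : ∀ cs → f (combination cs) ≡ ∑[ c ∈ cs ] (proj₁ c * f (charVec (proj₂ c)))
  f-combination []            = linear⇒zero f-lin
  f-combination ((a , W) ∷ cs) =
    trans (f-lin a (charVec W) (combination cs)) (cong (a * f (charVec W) +_) (f-combination cs))

  weighted-bound : ∀ {c} → c ∈ cs → proj₁ c * f (charVec (proj₂ c)) ≤ proj₁ c * r
  weighted-bound {a , W} c∈cs =
    ℚₚ.*-monoˡ-≤-nonNeg a {{ℚ.nonNegative (All.lookup cs≥0 c∈cs)}} (f[W]≤r W)

offDiagonal : ∀ {n} → Point n → Point n
offDiagonal x j j′ = if does (j ≟ j′) then 0ℚ else x j j′

offDiagonal-≢ : ∀ {n} (x : Point n) {j j′} → ¬ j ≡ j′ → offDiagonal x j j′ ≡ x j j′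
offDiagonal-≢ x {j} {j′} j≢j′ rewrite dec-false (j ≟ j′) j≢j′ = refl

offDiagonal-diagonal : ∀ {n} (x : Point n) j → offDiagonal x j j ≡ 0ℚ
offDiagonal-diagonal x j rewrite dec-true (j ≟ j) refl = refl

inNc-≢ : ∀ {n} {i₁ i₂ j : Fin n} → T (inNc i₁ i₂ j) → ¬ j ≡ i₁ × ¬ j ≡ i₂
inNc-≢ {i₁ = i₁} {i₂} {j} j∈Nc with j ≟ i₁ | j ≟ i₂
... | no j≢i₁ | no j≢i₂ = j≢i₁ , j≢i₂
... | yes _   | _       = ⊥-elim j∈Nc
... | no _    | yes _   = ⊥-elim j∈Nc

offDiagonal-arcDetermined : ∀ {n} (j j′ : Fin n) → ArcDetermined (λ x → offDiagonal x j j′)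
offDiagonal-arcDetermined j j′ with j ≟ j′
... | yes _    = zero-arcDetermined
... | no j≢j′ = coord-arcDetermined j≢j′

module _ {n : ℕ} (i₁ i₂ : Fin n) where

  ΣNc-linear : ∀ {φ : Fin n → Point n → ℚ} → (∀ j → Linear (φ j)) → Linear (λ x → ΣNc i₁ i₂ (λ j → φ j x))
  ΣNc-linear φ-lin = ∑-linear (allFin n) (λ j → if-linear (inNc i₁ i₂ j) (φ-lin j) zero-linear)

  ΣNc-arcDetermined : ∀ {φ : Fin n → Point n → ℚ} → (∀ j → T (inNc i₁ i₂ j) → ArcDetermined (φ j)) →
                      ArcDetermined (λ x → ΣNc i₁ i₂ (λ j → φ j x))
  ΣNc-arcDetermined φ-ad =
    ∑-arcDetermined (allFin n) (λ j → if-arcDetermined (inNc i₁ i₂ j) (φ-ad j) (λ _ → zero-arcDetermined))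

  lhs4-linear : Linear (lhs4 i₁ i₂)
  lhs4-linear =
    -‿linear (-‿linear (+-linear (coord-linear i₁ i₂)
                                  (ΣNc-linear λ j → +-linear (coord-linear i₁ j) (coord-linear j i₁)))
                       (ΣNc-linear λ j → ΣNc-linear λ j′ →
                          if-linear (does (j ≟ j′)) zero-linear (coord-linear j j′)))
             (ΣNc-linear λ j → coord-linear j i₂)

  lhs4-arcDetermined : ¬ i₁ ≡ i₂ → ArcDetermined (lhs4 i₁ i₂)
  lhs4-arcDetermined i₁≢i₂ =
    -‿arcDetermined
      (-‿arcDetermined
        (+-arcDetermined (coord-arcDetermined i₁≢i₂)
          (ΣNc-arcDetermined λ j j∈Nc → +-arcDetermined (coord-arcDetermined (≢-sym (proj₁ (inNc-≢ j∈Nc))))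
                                                         (coord-arcDetermined (proj₁ (inNc-≢ j∈Nc)))))
        (ΣNc-arcDetermined λ j _ → ΣNc-arcDetermined λ j′ _ → offDiagonal-arcDetermined j j′))
      (ΣNc-arcDetermined λ j j∈Nc → coord-arcDetermined (proj₂ (inNc-≢ j∈Nc)))

filterᵇ-∧-≢ : ∀ {n} (P : Fin n → Bool) {i} {L} → All (λ j → ¬ i ≡ j) L →
              filterᵇ (λ j → P j ∧ not (does (j ≟ i))) L ≡ filterᵇ P L
filterᵇ-∧-≢ P []                 = refl
filterᵇ-∧-≢ P {i} {j ∷ L} (i≢j ∷ i∉L) rewrite dec-false (j ≟ i) (≢-sym i≢j) with P j
... | true  = cong (j ∷_) (filterᵇ-∧-≢ P i∉L)
... | false = filterᵇ-∧-≢ P i∉L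

length-filterᵇ-remove : ∀ {n} (P : Fin n → Bool) {i} {L} → Unique L → i ∈ L → P i ≡ true →
                        suc (length (filterᵇ (λ j → P j ∧ not (does (j ≟ i))) L)) ≡ length (filterᵇ P L)
length-filterᵇ-remove P {i} (i∉L ∷ _) (here refl) Pi rewrite Pi | dec-true (i ≟ i) refl =
  cong (suc ∘ length) (filterᵇ-∧-≢ P i∉L)
length-filterᵇ-remove P {i} {j ∷ L} (j∉L ∷ L-unique) (there i∈L) Pi
  rewrite dec-false (j ≟ i) (All.lookup j∉L i∈L) with P j
... | true  = cong suc (length-filterᵇ-remove P L-unique i∈L Pi)
... | false = length-filterᵇ-remove P L-unique i∈L Pi

Nc : ∀ {n} → Fin n → Fin n → List (Fin n)
Nc {n} i₁ i₂ = filterᵇ (inNc i₁ i₂) (allFin n)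

Nc-unique : ∀ {n} (i₁ i₂ : Fin n) → Unique (Nc i₁ i₂)
Nc-unique {n} i₁ i₂ = Uniqueₚ.filter⁺ (T? ∘ inNc i₁ i₂) (Uniqueₚ.allFin⁺ n)

ΣNc-∑ : ∀ {n} (i₁ i₂ : Fin n) f → ΣNc i₁ i₂ f ≡ ∑ (Nc i₁ i₂) f
ΣNc-∑ {n} i₁ i₂ = ∑-filterᵇ (inNc i₁ i₂) (allFin n)

length-Nc : ∀ {n} {i₁ i₂ : Fin n} → ¬ i₁ ≡ i₂ → suc (suc (length (Nc i₁ i₂))) ≡ n
length-Nc {n} {i₁} {i₂} i₁≢i₂ = begin
  suc (suc (length (Nc i₁ i₂)))
    ≡⟨ cong suc (length-filterᵇ-remove (λ j → not (does (j ≟ i₁))) (Uniqueₚ.allFin⁺ n) (∈-allFin i₂)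
                                       (cong not (dec-false (i₂ ≟ i₁) (≢-sym i₁≢i₂)))) ⟩
  suc (length (filterᵇ (λ j → not (does (j ≟ i₁))) (allFin n)))
    ≡⟨ length-filterᵇ-remove (λ _ → true) (Uniqueₚ.allFin⁺ n) (∈-allFin i₁) refl ⟩
  length (filterᵇ (λ _ → true) (allFin n))
    ≡⟨ cong length (Listₚ.filter-all (T? ∘ λ _ → true) (All.universal _ (allFin n))) ⟩
  length (allFin n)
    ≡⟨ Listₚ.length-tabulate id ⟩
  n ∎
  where open ≡-Reasoning

module _ {n : ℕ} (W : WeakOrder n) where
  open WeakOrder W using (R; total)

  charVec-total : ∀ i j → 1ℚ ≤ charVec W i j + charVec W j i
  charVec-total i j with R i j | R j i | total i j
  ... | true  | true  | _      = ≤-byComputation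
  ... | true  | false | _      = ≤-byComputation
  ... | false | true  | _      = ≤-byComputation
  ... | false | false | inj₁ ()
  ... | false | false | inj₂ ()

  charVec-tied : ∀ i j → R i j ≡ true → R j i ≡ true → charVec W i j + charVec W j i ≡ 1ℚ + 1ℚ
  charVec-tied i j Rij Rji rewrite Rij | Rji = refl

  pairSum : List (Fin n) → ℚ
  pairSum L = ∑[ j ∈ L ] ∑[ j′ ∈ L ] offDiagonal (charVec W) j j′

  crossSum : Fin n → List (Fin n) → ℚ
  crossSum j L = ∑[ i ∈ L ] (charVec W j i + charVec W i j)

  pairSum-∷ : ∀ j L → All (λ i → ¬ j ≡ i) L →
              pairSum (j ∷ L) ≡ crossSum j L + pairSum L
  pairSum-∷ j L j∉L = begin
    (off j j + ∑[ i ∈ L ] off j i) + ∑[ i ∈ L ] (off i j + ∑[ i′ ∈ L ] off i i′)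
      ≡⟨ cong₂ (λ a b → (a + ∑[ i ∈ L ] off j i) + b) (offDiagonal-diagonal x j) (∑-+ L (λ i → off i j) _) ⟩
    (0ℚ + ∑[ i ∈ L ] off j i) + (∑[ i ∈ L ] off i j + pairSum L)
      ≡⟨ cong₂ (λ a b → (0ℚ + a) + (b + pairSum L)) (∑-cong L (λ i∈L → offDiagonal-≢ x (j≢ i∈L)))
                                                      (∑-cong L (λ i∈L → offDiagonal-≢ x (≢-sym (j≢ i∈L)))) ⟩
    (0ℚ + ∑[ i ∈ L ] x j i) + (∑[ i ∈ L ] x i j + pairSum L)
      ≡⟨ solve 3 (λ a b p → (con 0ℚ :+ a) :+ (b :+ p) := (a :+ b) :+ p)
                 refl (∑ L (x j)) (∑[ i ∈ L ] x i j) (pairSum L) ⟩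
    (∑[ i ∈ L ] x j i + ∑[ i ∈ L ] x i j) + pairSum L
      ≡⟨ cong (_+ pairSum L) (∑-+ L (x j) (λ i → x i j)) ⟨
    ∑[ i ∈ L ] (x j i + x i j) + pairSum L ∎
    where
    open ≡-Reasoning
    open +-*-Solver
    x = charVec W
    off = offDiagonal x
    j≢ : ∀ {i} → i ∈ L → ¬ j ≡ i
    j≢ = All.lookup j∉L

  pairSum-∷-≥ : ∀ j L → All (λ i → ¬ j ≡ i) L → ∀ {c p} →
                fromℕ c ≤ crossSum j L → fromℕ p ≤ pairSum L → fromℕ (c ℕ.+ p) ≤ pairSum (j ∷ L)
  pairSum-∷-≥ j L j∉L {c} {p} c≤ p≤ = begin
    fromℕ (c ℕ.+ p)          ≡⟨ fromℕ-+ c p ⟩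
    fromℕ c + fromℕ p        ≤⟨ ℚₚ.+-mono-≤ c≤ p≤ ⟩
    crossSum j L + pairSum L ≡⟨ pairSum-∷ j L j∉L ⟨
    pairSum (j ∷ L)          ∎
    where open ℚₚ.≤-Reasoning

  crossSum-≥ : ∀ j L → fromℕ (length L) ≤ crossSum j L
  crossSum-≥ j L = begin
    fromℕ (length L)  ≡⟨ ∑-1 L ⟨
    ∑[ i ∈ L ] 1ℚ     ≤⟨ ∑-mono-≤ L (λ {i} _ → charVec-total j i) ⟩
    crossSum j L      ∎
    where open ℚₚ.≤-Reasoning

  module _ (Tied : Fin n → Bool) (tied-related : ∀ i j → Tied i ≡ true → Tied j ≡ true → R i j ≡ true) where

    crossSum-tied-≥ : ∀ {j} → Tied j ≡ true → ∀ L →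
                      fromℕ (length L ℕ.+ length (filterᵇ Tied L)) ≤ crossSum j L
    crossSum-tied-≥ {j} Tj L = begin
      fromℕ (length L ℕ.+ length (filterᵇ Tied L))        ≡⟨ fromℕ-+ (length L) _ ⟩
      fromℕ (length L) + fromℕ (length (filterᵇ Tied L))  ≡⟨ cong₂ _+_ (∑-1 L) (∑-𝟙 Tied L) ⟨
      ∑[ i ∈ L ] 1ℚ + ∑[ i ∈ L ] 𝟙 (Tied i)               ≡⟨ ∑-+ L (λ _ → 1ℚ) (λ i → 𝟙 (Tied i)) ⟨
      ∑[ i ∈ L ] (1ℚ + 𝟙 (Tied i))                        ≤⟨ ∑-mono-≤ L (λ {i} _ → pair-≥ i) ⟩
      crossSum j L                                        ∎
      where
      open ℚₚ.≤-Reasoning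
      pair-≥ : ∀ i → 1ℚ + 𝟙 (Tied i) ≤ charVec W j i + charVec W i j
      pair-≥ i with Tied i in Ti
      ... | true  = ℚₚ.≤-reflexive (sym (charVec-tied j i (tied-related j i Tj Ti) (tied-related i j Ti Tj)))
      ... | false = charVec-total j i

    pairSum-≥ : ∀ L → Unique L → fromℕ (C₂ (length L) ℕ.+ C₂ (length (filterᵇ Tied L))) ≤ pairSum L
    pairSum-≥ []      []                 = ℚₚ.≤-refl
    pairSum-≥ (j ∷ L) (j∉L ∷ L-unique) with Tied j in Tj
    ... | true  = subst (λ m → fromℕ m ≤ pairSum (j ∷ L)) (interchange k b (C₂ k) (C₂ b))
                        (pairSum-∷-≥ j L j∉L {k ℕ.+ b} (crossSum-tied-≥ Tj L) (pairSum-≥ L L-unique))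
      where
      k = length L
      b = length (filterᵇ Tied L)
    ... | false = subst (λ m → fromℕ m ≤ pairSum (j ∷ L)) (sym (ℕₚ.+-assoc k (C₂ k) (C₂ b)))
                        (pairSum-∷-≥ j L j∉L {k} (crossSum-≥ j L) (pairSum-≥ L L-unique))
      where
      k = length L
      b = length (filterᵇ Tied L)

𝟙-arc : ∀ a b c → 𝟙 a + 𝟙 b ≤ 𝟙 c + (1ℚ + 𝟙 (a ∧ b ∧ not c))
𝟙-arc true  true  true  = ≤-byComputation
𝟙-arc true  true  false = ≤-byComputation
𝟙-arc true  false true  = ≤-byComputation
𝟙-arc true  false false = ≤-byComputation
𝟙-arc false true  true  = ≤-byComputation
𝟙-arc false true  false = ≤-byComputation
𝟙-arc false false true  = ≤-byComputation
𝟙-arc false false false = ≤-byComputation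

module _ {n : ℕ} (i₁ i₂ : Fin n) (W : WeakOrder n) where
  open WeakOrder W using (R) renaming (trans to R-trans)

  tied₁-below₂ : Fin n → Bool
  tied₁-below₂ j = R i₁ j ∧ R j i₁ ∧ not (R j i₂)

  #tied₁-below₂ : List (Fin n) → ℕ
  #tied₁-below₂ L = length (filterᵇ tied₁-below₂ L)

  tied₁-below₂-related : ∀ i j → tied₁-below₂ i ≡ true → tied₁-below₂ j ≡ true → R i j ≡ true
  tied₁-below₂-related i j Bi Bj =
    R-trans i i₁ j (∧-conicalˡ _ _ (∧-conicalʳ (R i₁ i) _ Bi)) (∧-conicalˡ _ _ Bj)

  tied₁-below₂-empty : R i₁ i₂ ≡ true → ∀ j → tied₁-below₂ j ≡ false
  tied₁-below₂-empty R₁₂ j with R j i₁ in Rj₁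
  ... | false = ∧-zeroʳ (R i₁ j)
  ... | true rewrite R-trans j i₁ i₂ Rj₁ R₁₂ = ∧-zeroʳ (R i₁ j)

  ∑-arcs-≤ : ∀ L → ∑[ j ∈ L ] (charVec W i₁ j + charVec W j i₁) ≤
                   ∑[ j ∈ L ] charVec W j i₂ + (fromℕ (length L) + fromℕ (#tied₁-below₂ L))
  ∑-arcs-≤ L = begin
    ∑[ j ∈ L ] (charVec W i₁ j + charVec W j i₁)
      ≤⟨ ∑-mono-≤ L (λ {j} _ → 𝟙-arc (R i₁ j) (R j i₁) (R j i₂)) ⟩
    ∑[ j ∈ L ] (charVec W j i₂ + (1ℚ + 𝟙 (tied₁-below₂ j)))
      ≡⟨ ∑-+ L (λ j → charVec W j i₂) _ ⟩
    ∑[ j ∈ L ] charVec W j i₂ + ∑[ j ∈ L ] (1ℚ + 𝟙 (tied₁-below₂ j))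
      ≡⟨ cong (∑[ j ∈ L ] charVec W j i₂ +_) (∑-+ L (λ _ → 1ℚ) _) ⟩
    ∑[ j ∈ L ] charVec W j i₂ + (∑[ j ∈ L ] 1ℚ + ∑[ j ∈ L ] 𝟙 (tied₁-below₂ j))
      ≡⟨ cong (λ t → ∑[ j ∈ L ] charVec W j i₂ + t) (cong₂ _+_ (∑-1 L) (∑-𝟙 tied₁-below₂ L)) ⟩
    ∑[ j ∈ L ] charVec W j i₂ + (fromℕ (length L) + fromℕ (#tied₁-below₂ L)) ∎
    where open ℚₚ.≤-Reasoning

  charVec₁₂+b-C₂b≤1 : ∀ L → charVec W i₁ i₂ + fromℕ (#tied₁-below₂ L) - fromℕ (C₂ (#tied₁-below₂ L)) ≤ 1ℚ
  charVec₁₂+b-C₂b≤1 L with R i₁ i₂ in R₁₂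
  ... | true
    rewrite Listₚ.filter-none (T? ∘ tied₁-below₂) (All.universal (λ j → subst T (tied₁-below₂-empty R₁₂ j)) L)
    = ≤-byComputation
  ... | false = begin
    0ℚ + fromℕ b - fromℕ (C₂ b) ≡⟨ cong (_- fromℕ (C₂ b)) (ℚₚ.+-identityˡ (fromℕ b)) ⟩
    fromℕ b - fromℕ (C₂ b)      ≤⟨ m-C₂m≤1 b ⟩
    1ℚ                          ∎
    where
    open ℚₚ.≤-Reasoning
    b = #tied₁-below₂ L

  lhs4-charVec-≤ : let k = length (Nc i₁ i₂) in lhs4 i₁ i₂ (charVec W) ≤ 1ℚ + fromℕ k - fromℕ (C₂ k)
  lhs4-charVec-≤ = begin
    lhs4 i₁ i₂ x
      ≡⟨ cong₂ _-_ (cong₂ _-_ (cong (x i₁ i₂ +_) (ΣNc-∑ i₁ i₂ _)) ΣNc²≡pairSum) (ΣNc-∑ i₁ i₂ _) ⟩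
    ((x i₁ i₂ + ∑[ j ∈ N ] (x i₁ j + x j i₁)) - pairSum W N) - C
      ≤⟨ ℚₚ.+-monoˡ-≤ (- C) (ℚₚ.+-mono-≤ (ℚₚ.+-monoʳ-≤ (x i₁ i₂) (∑-arcs-≤ N)) (ℚₚ.neg-antimono-≤ pairSum-≥N)) ⟩
    ((x i₁ i₂ + (C + (fromℕ k + fromℕ b))) - fromℕ (C₂ k ℕ.+ C₂ b)) - C
      ≡⟨ cong (λ t → ((x i₁ i₂ + (C + (fromℕ k + fromℕ b))) - t) - C) (fromℕ-+ (C₂ k) (C₂ b)) ⟩
    ((x i₁ i₂ + (C + (fromℕ k + fromℕ b))) - (fromℕ (C₂ k) + fromℕ (C₂ b))) - C
      ≡⟨ solve 6 (λ x c k b ck cb → ((x :+ (c :+ (k :+ b))) :- (ck :+ cb)) :- c := (x :+ b :- cb) :+ (k :- ck))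
                 refl (x i₁ i₂) C (fromℕ k) (fromℕ b) (fromℕ (C₂ k)) (fromℕ (C₂ b)) ⟩
    (x i₁ i₂ + fromℕ b - fromℕ (C₂ b)) + (fromℕ k - fromℕ (C₂ k))
      ≤⟨ ℚₚ.+-monoˡ-≤ (fromℕ k - fromℕ (C₂ k)) (charVec₁₂+b-C₂b≤1 N) ⟩
    1ℚ + (fromℕ k - fromℕ (C₂ k))
      ≡⟨ ℚₚ.+-assoc 1ℚ (fromℕ k) (- fromℕ (C₂ k)) ⟨
    1ℚ + fromℕ k - fromℕ (C₂ k) ∎
    where
    open ℚₚ.≤-Reasoning
    open +-*-Solver
    x = charVec W
    N = Nc i₁ i₂
    k = length N
    b = #tied₁-below₂ N
    C = ∑[ j ∈ N ] x j i₂
    ΣNc²≡pairSum : ΣNc² i₁ i₂ x ≡ pairSum W N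
    ΣNc²≡pairSum = trans (ΣNc-∑ i₁ i₂ _) (∑-cong N (λ _ → ΣNc-∑ i₁ i₂ _))
    pairSum-≥N : fromℕ (C₂ k ℕ.+ C₂ b) ≤ pairSum W N
    pairSum-≥N = pairSum-≥ W tied₁-below₂ tied₁-below₂-related N (Nc-unique i₁ i₂)

1+m-C₂m≡rhs4 : ∀ m → 1ℚ + fromℕ (suc m) - fromℕ (C₂ (suc m)) ≡ rhs4 (3 ℕ.+ m)
1+m-C₂m≡rhs4 m = begin
  1ℚ + fromℕ (suc m) - fromℕ (m ℕ.+ C₂ m)
    ≡⟨ cong₂ (λ a c → 1ℚ + a - c) (fromℕ-suc m) (fromℕ-+ m (C₂ m)) ⟩
  1ℚ + (1ℚ + fromℕ m) - (fromℕ m + fromℕ (C₂ m))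
    ≡⟨ solve 2 (λ a c → con 1ℚ :+ (con 1ℚ :+ a) :- (a :+ c) := con (fromℕ 2) :- c) refl (fromℕ m) (fromℕ (C₂ m)) ⟩
  fromℕ 2 - fromℕ (C₂ m)
    ≡⟨ cong (λ t → fromℕ 2 - t) [m[m-1]]/2≡C₂m ⟨
  rhs4 (3 ℕ.+ m) ∎
  where
  open ≡-Reasoning
  open +-*-Solver
  [m[m-1]]/2≡C₂m : ℤ.+ (m ℕ.* (m ℕ.∸ 1)) / 2 ≡ fromℕ (C₂ m)
  [m[m-1]]/2≡C₂m = trans (cong (λ t → ℤ.+ t / 2) (sym (C₂-double m))) ([m+m]/2≡fromℕ (C₂ m))

lhs4-charVec-≤-rhs4 : ∀ {n} → 3 ℕ.≤ n → {i₁ i₂ : Fin n} → ¬ i₁ ≡ i₂ → ∀ W → lhs4 i₁ i₂ (charVec W) ≤ rhs4 n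
lhs4-charVec-≤-rhs4 (s≤s (s≤s (s≤s {n = m} _))) {i₁} {i₂} i₁≢i₂ W = begin
  lhs4 i₁ i₂ (charVec W)                                    ≤⟨ lhs4-charVec-≤ i₁ i₂ W ⟩
  1ℚ + fromℕ (length (Nc i₁ i₂)) - fromℕ (C₂ (length (Nc i₁ i₂)))
    ≡⟨ cong (λ k → 1ℚ + fromℕ k - fromℕ (C₂ k)) |Nc|≡1+m ⟩
  1ℚ + fromℕ (suc m) - fromℕ (C₂ (suc m))                   ≡⟨ 1+m-C₂m≡rhs4 m ⟩
  rhs4 (3 ℕ.+ m)                                            ∎
  where
  open ℚₚ.≤-Reasoning
  |Nc|≡1+m : length (Nc i₁ i₂) ≡ suc m
  |Nc|≡1+m = ℕₚ.suc-injective (ℕₚ.suc-injective (length-Nc i₁≢i₂))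

theorem4 : (n : ℕ) → 4 ℕ.≤ n → (i₁ i₂ : Fin n) → ¬ (i₁ ≡ i₂) →
    ValidForPWO n (lhs4 i₁ i₂) (rhs4 n)
theorem4 n 4≤n i₁ i₂ i₁≢i₂ =
  validForPWO-fromVertices (lhs4-linear i₁ i₂) (lhs4-arcDetermined i₁ i₂ i₁≢i₂)
                           (lhs4-charVec-≤-rhs4 (ℕₚ.<⇒≤ 4≤n) i₁≢i₂)
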